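{- For every integer $n\ge 2$, $\Sigma_{\mathrm{DR}}(2,n)\le (n-2)^2$.
   Context: Let $S=\{1,\dots,n\}$ (the symbol set) and let $\binom{S}{d}$ denote the set of $d$-element subsets of $S$. A $d$-dimensional subset partition graph on $S$ is a connected graph $G=(\mathcal V,E)$ whose vertex set $\mathcal V=\{\mathcal V_1,\dots,\mathcal V_k\}$ is a partition of some set $\mathcal A\subseteq\binom{S}{d}$: the $\mathcal V_i$ are pairwise disjoint, nonempty, and their union is $\mathcal A$. For $F\subseteq S$, the restriction $G_F$ is the graph obtained from $G$ by replacing $\mathcal A$ with $\mathcal A_F=\{A\in\mathcal A: F\subseteq A\}$, removing every vertex $\mathcal V_i$ with $\mathcal V_i\cap\mathcal A_F=\emptyset$ together with its incident edges, and keeping the remaining vertices and edges among them. $G$ satisfies dimension reduction if for every $F\subseteq S$ with $|F|\le d$ the restriction $G_F$ is connected. The diameter of $G$ is the maximum over pairs of vertices of the graph distance between them. $\Sigma_{\mathrm{DR}}(d,n)$ denotes the maximum diameter among $d$-dimensional subset partition graphs on the symbol set $\{1,\dots,n\}$ satisfying dimension reduction. -}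

module Defs where

open import Data.Nat using (ℕ; zero; suc; _≤_)
open import Data.Fin using (Fin)
open import Data.Fin.Subset using (Subset; _⊆_; ∣_∣)
open import Data.Maybe using (Maybe; just; nothing)
open import Data.Product using (∃; ∃-syntax; _×_; Σ-syntax)
open import Data.Unit using (⊤)
open import Relation.Binary.PropositionalEquality using (_≡_; _≢_)
open import Relation.Nullary using (¬_)

data Walk {k : ℕ} (P : Fin k → Set) (E : Fin k → Fin k → Set)
          : Fin k → Fin k → ℕ → Set where
  here : ∀ {i} → P i → Walk P E i i zero
  step : ∀ {i j l m} → P i → E i j → Walk P E j l m → Walk P E i l (suc m)

Connected : {k : ℕ} → (Fin k → Set) → (Fin k → Fin k → Set) → Set
Connected P E = ∀ i j → P i → P j → ∃[ m ] Walk P E i j m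

-- A d-dimensional subset partition graph on the symbol set S = Fin n.
-- The vertices are V_0,...,V_{k-1}; the partition of A ⊆ (S choose d) is
-- encoded by  part : Subset n → Maybe (Fin k):  part A ≡ just i  means A ∈ V_i,
-- part A ≡ nothing means A ∉ 𝒜.
record SPG (n d : ℕ) : Set₁ where
  field
    k         : ℕ
    part      : Subset n → Maybe (Fin k)
    part-dim  : ∀ A i → part A ≡ just i → ∣ A ∣ ≡ d
    nonempty  : ∀ i → ∃[ A ] part A ≡ just i
    E         : Fin k → Fin k → Set
    E-sym     : ∀ i j → E i j → E j i
    E-irrefl  : ∀ i → ¬ E i i
    connected : Connected (λ _ → ⊤) E

Survives : ∀ {n d} (G : SPG n d) → Subset n → Fin (SPG.k G) → Set
Survives G F i = ∃[ A ] (F ⊆ A × SPG.part G A ≡ just i)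

DimReduction : ∀ {n d} → SPG n d → Set
DimReduction {n} {d} G =
  ∀ (F : Subset n) → ∣ F ∣ ≤ d → Connected (Survives G F) (SPG.E G)

DiameterAtMost : ∀ {n d} → SPG n d → ℕ → Set
DiameterAtMost G D =
  ∀ i j → ∃[ m ] (m ≤ D × Walk (λ _ → ⊤) (SPG.E G) i j m)

module Submission where

-- Every bound comes from one pigeonhole fact (shortWalk): if the vertices of an
-- induced subgraph have injective codes in Fin N, any walk in that subgraph can be
-- replaced by one of length < N, since a longer walk visits some vertex twice and
-- the closed subwalk in between can be cut out.  Codes are obtained by picking a
-- 2-set in every part V_i; as the parts are disjoint, distinct vertices get distinct
-- 2-sets, and we code 2-sets by counting them:
--   * all 2-subsets of n symbols:             choose2 n = n(n-1)/2 codes,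
--   * the 2-subsets containing a fixed symbol: n-1 codes (the other element).
-- For a 2-dimensional graph on n symbols this gives
--   (a) diameter ≤ choose2 n - 1                           (whole graph),
--   (b) distance ≤ n - 2 between vertices having 2-sets with a common symbol s
--       (both survive in G_{s}, which is connected by dimension reduction),
--   (c) diameter ≤ choose2 n - 2 if some 2-set does not occur in 𝒜.
-- Since choose2 n - 1 ≤ (n-2)² for n = 2 and n ≥ 5, (a) settles these cases.
-- For n = 3 any two 2-sets meet, so (b) gives distance ≤ 1.  For n = 4 two
-- vertices either have meeting 2-sets, then (b) gives ≤ 2, or disjoint ones {a,b}
-- and {c,d}: if {a,c} lies in a part V_w then (b) twice gives ≤ 2 + 2 through w,
-- and otherwise (c) gives ≤ 4.

open import Defs
open import Data.Nat using (ℕ; zero; suc; pred; _+_; _*_; _∸_; _^_; _≤_; _<_; z≤n; s≤s; _<?_)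
open import Data.Nat.Properties
  using (≤-refl; ≤-trans; ≤-reflexive; ≤-pred; ≮⇒≥; m≤n+m; m≤m+n;
         +-monoˡ-<; +-monoʳ-≤; +-mono-≤; m+[n∸m]≡n; suc-injective; ≤⇒≯; <⇒≤pred; m≤o∸n⇒m+n≤o; module ≤-Reasoning)
open import Data.Nat.Induction using (<-rec)
open import Data.Nat.Tactic.RingSolver using (solve-∀)
open import Data.Fin as Fin using (Fin; toℕ; _↑ˡ_; _↑ʳ_; punchOut)
open import Data.Fin.Properties as FinP using (pigeonhole; any?; toℕ<n; ↑ˡ-injective; ↑ʳ-injective; punchOut-injective)
open import Data.Fin.Subset using (Subset; Nonempty; _⊆_; _∈_; ∣_∣; ⁅_⁆; _∪_; ⊥; ∁)
open import Data.Fin.Subset.Properties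
  using (_∈?_; ∉⊥; x∈⁅x⁆; x∈⁅y⁆⇒x≡y; ∣⁅x⁆∣≡1; ∪-identityˡ; ∪-identityʳ; p⊆p∪q; q⊆p∪q;
         p⊆q⇒∣p∣≤∣q∣; ∣p∣≤n; ∣∁p∣≡n∸∣p∣; x∉p⇒x∈∁p)
open import Data.Vec.Base using ([]; _∷_; here; there)
open import Data.Bool using (true; false)
open import Data.Maybe using (just; nothing)
open import Data.Maybe.Properties using (just-injective)
open import Data.Product using (∃-syntax; Σ-syntax; _×_; _,_; proj₁; proj₂)
open import Data.Unit using (⊤; tt)
open import Relation.Binary.PropositionalEquality
open import Function using (_∘_)
open import Relation.Nullary using (Dec; yes; no; contradiction)
open import Relation.Nullary.Decidable using (_×-dec_)

module _ {k : ℕ} {P : Fin k → Set} {E : Fin k → Fin k → Set} where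

  walk-start : ∀ {i j m} → Walk P E i j m → P i
  walk-start (here p)     = p
  walk-start (step p _ _) = p

  _++ʷ_ : ∀ {i j l a b} → Walk P E i j a → Walk P E j l b → Walk P E i l (a + b)
  here _     ++ʷ w′ = w′
  step p e w ++ʷ w′ = step p e (w ++ʷ w′)

  forget : ∀ {i j m} → Walk P E i j m → Walk (λ _ → ⊤) E i j m
  forget (here _)     = here tt
  forget (step _ e w) = step tt e (forget w)

  splitWalk : ∀ {i j m} → Walk P E i j m → (p : Fin (suc m)) →
              Σ[ v ∈ Fin k ] (Walk P E i v (toℕ p) × Walk P E v j (m ∸ toℕ p))
  splitWalk {i} w            Fin.zero    = i , here (walk-start w) , w
  splitWalk     (step p e w) (Fin.suc q) with splitWalk w q
  ... | v , w₁ , w₂ = v , step p e w₁ , w₂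

  cut-length : ∀ m p q → p < q → q ≤ m → p + (m ∸ q) < m
  cut-length m p q p<q q≤m =
    ≤-trans (+-monoˡ-< (m ∸ q) p<q) (≤-reflexive (m+[n∸m]≡n q≤m))

  module _ {N : ℕ} (code : ∀ x → P x → Fin N)
           (code-injective : ∀ {x y} p q → code x p ≡ code y q → x ≡ y) where

    visited : ∀ {i j m} → Walk P E i j m → Fin (suc m) → Fin N
    visited w p = code _ (walk-start (proj₂ (proj₂ (splitWalk w p))))

    -- A walk of length ≥ N repeats a vertex, so a strictly shorter walk exists.
    shortcut : ∀ {i j m} → Walk P E i j m → N ≤ m → ∃[ m′ ] (m′ < m × Walk P E i j m′)
    shortcut {m = m} w N≤m with pigeonhole (s≤s N≤m) (visited w)
    ... | p , q , p<q , same-code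
        with splitWalk w p | splitWalk w q | code-injective _ _ same-code
    ... | v , before , _ | .v , _ , after | refl =
      toℕ p + (m ∸ toℕ q) , cut-length m (toℕ p) (toℕ q) p<q (≤-pred (toℕ<n q)) ,
      before ++ʷ after

    shortWalk : ∀ {i j m} → Walk P E i j m → ∃[ m′ ] (m′ < N × Walk P E i j m′)
    shortWalk {m = m} = <-rec Shortenable shorten m
      where
      Shortenable : ℕ → Set
      Shortenable m = ∀ {i j} → Walk P E i j m → ∃[ m′ ] (m′ < N × Walk P E i j m′)
      shorten : ∀ m → (∀ {m′} → m′ < m → Shortenable m′) → Shortenable m
      shorten m shorter w with m <? N
      ... | yes m<N = m , m<N , w
      ... | no  m≮N with shortcut w (≮⇒≥ m≮N)
      ... | m′ , m′<m , w′ = shorter m′<m w′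

size0⇒⊥ : ∀ {n} (A : Subset n) → ∣ A ∣ ≡ 0 → A ≡ ⊥
size0⇒⊥ []          _     = refl
size0⇒⊥ (false ∷ A) ∣A∣≡0 = cong (false ∷_) (size0⇒⊥ A ∣A∣≡0)
size0⇒⊥ (true ∷ A)  ()

member : ∀ {n t} (A : Subset n) → ∣ A ∣ ≡ suc t → Nonempty A
member (true ∷ A)  _ = Fin.zero , here
member (false ∷ A) ∣A∣≡1+t with member A ∣A∣≡1+t
... | x , x∈A = Fin.suc x , there x∈A

size1⇒⁅⁆ : ∀ {n} (A : Subset n) → ∣ A ∣ ≡ 1 → ∀ {x} → x ∈ A → A ≡ ⁅ x ⁆
size1⇒⁅⁆ (true ∷ A)  ∣A∣≡1 here = cong (true ∷_) (size0⇒⊥ A (suc-injective ∣A∣≡1))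
size1⇒⁅⁆ (true ∷ A)  ∣A∣≡1 (there x∈A) =
  contradiction (subst (_ ∈_) (size0⇒⊥ A (suc-injective ∣A∣≡1)) x∈A) ∉⊥
size1⇒⁅⁆ (false ∷ A) ∣A∣≡1 (there x∈A) = cong (false ∷_) (size1⇒⁅⁆ A ∣A∣≡1 x∈A)

size1-unique : ∀ {n} (A B : Subset n) → ∣ A ∣ ≡ 1 → ∣ B ∣ ≡ 1 →
               ∀ {x} → x ∈ A → x ∈ B → A ≡ B
size1-unique A B ∣A∣≡1 ∣B∣≡1 x∈A x∈B = trans (size1⇒⁅⁆ A ∣A∣≡1 x∈A) (sym (size1⇒⁅⁆ B ∣B∣≡1 x∈B))

index₁ : ∀ {n} (A : Subset n) → ∣ A ∣ ≡ 1 → Fin n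
index₁ A ∣A∣≡1 = proj₁ (member A ∣A∣≡1)

index₁-injective : ∀ {n} (A B : Subset n) p q → index₁ A p ≡ index₁ B q → A ≡ B
index₁-injective A B p q same =
  size1-unique A B p q (proj₂ (member A p)) (subst (_∈ B) (sym same) (proj₂ (member B q)))

choose2 : ℕ → ℕ
choose2 zero    = 0
choose2 (suc n) = n + choose2 n

↑ˡ≢↑ʳ : ∀ {m n} (i : Fin m) (j : Fin n) → i ↑ˡ n ≢ m ↑ʳ j
↑ˡ≢↑ʳ Fin.zero    j ()
↑ˡ≢↑ʳ (Fin.suc i) j eq = ↑ˡ≢↑ʳ i j (FinP.suc-injective eq)

-- Codes of the 2-subsets of Fin (1+n): one containing 0 gets one of the first n codes
-- (its other element), one avoiding 0 its code as a 2-subset of the other n symbols.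
index₂ : ∀ {n} (A : Subset n) → ∣ A ∣ ≡ 2 → Fin (choose2 n)
index₂ {suc n} (true ∷ A)  ∣A∣≡2 = index₁ A (suc-injective ∣A∣≡2) ↑ˡ choose2 n
index₂ {suc n} (false ∷ A) ∣A∣≡2 = n ↑ʳ index₂ A ∣A∣≡2

index₂-injective : ∀ {n} (A B : Subset n) p q → index₂ A p ≡ index₂ B q → A ≡ B
index₂-injective {suc n} (true ∷ A) (true ∷ B) p q same =
  cong (true ∷_) (index₁-injective A B _ _ (↑ˡ-injective (choose2 n) _ _ same))
index₂-injective {suc n} (true ∷ A) (false ∷ B) p q same = contradiction same (↑ˡ≢↑ʳ _ _)
index₂-injective {suc n} (false ∷ A) (true ∷ B) p q same = contradiction (sym same) (↑ˡ≢↑ʳ _ _)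
index₂-injective {suc n} (false ∷ A) (false ∷ B) p q same =
  cong (false ∷_) (index₂-injective A B p q (↑ʳ-injective n _ _ same))

-- A 2-subset of Fin (1+n) containing a fixed symbol s is coded by its other element.
partnerIndex : ∀ {n} (s : Fin (suc n)) (A : Subset (suc n)) → s ∈ A → ∣ A ∣ ≡ 2 → Fin n
partnerIndex         Fin.zero    (true ∷ A)  here        ∣A∣≡2 = index₁ A (suc-injective ∣A∣≡2)
partnerIndex {suc n} (Fin.suc s) (true ∷ A)  (there _)   ∣A∣≡2 = Fin.zero
partnerIndex {suc n} (Fin.suc s) (false ∷ A) (there s∈A) ∣A∣≡2 = Fin.suc (partnerIndex s A s∈A ∣A∣≡2)

partnerIndex-injective : ∀ {n} s (A B : Subset (suc n)) s∈A s∈B p q →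
                         partnerIndex s A s∈A p ≡ partnerIndex s B s∈B q → A ≡ B
partnerIndex-injective Fin.zero (true ∷ A) (true ∷ B) here here p q same =
  cong (true ∷_) (index₁-injective A B _ _ same)
partnerIndex-injective {suc n} (Fin.suc s) (true ∷ A) (true ∷ B) (there s∈A) (there s∈B) p q _ =
  cong (true ∷_) (size1-unique A B (suc-injective p) (suc-injective q) s∈A s∈B)
partnerIndex-injective {suc n} (Fin.suc s) (false ∷ A) (false ∷ B) (there s∈A) (there s∈B) p q same =
  cong (false ∷_) (partnerIndex-injective s A B s∈A s∈B p q (FinP.suc-injective same))

pair-size : ∀ {n} (a c : Fin n) → a ≢ c → ∣ ⁅ a ⁆ ∪ ⁅ c ⁆ ∣ ≡ 2
pair-size Fin.zero    Fin.zero    a≢c = contradiction refl a≢c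
pair-size Fin.zero    (Fin.suc c) a≢c = cong suc (trans (cong ∣_∣ (∪-identityˡ ⁅ c ⁆)) (∣⁅x⁆∣≡1 c))
pair-size (Fin.suc a) Fin.zero    a≢c = cong suc (trans (cong ∣_∣ (∪-identityʳ ⁅ a ⁆)) (∣⁅x⁆∣≡1 a))
pair-size (Fin.suc a) (Fin.suc c) a≢c = pair-size a c (a≢c ∘ cong Fin.suc)

meet? : ∀ {n} (A B : Subset n) → Dec (∃[ x ] (x ∈ A × x ∈ B))
meet? A B = any? (λ x → (x ∈? A) ×-dec (x ∈? B))

subsets-meet : ∀ {n} (A B : Subset n) → n < ∣ A ∣ + ∣ B ∣ → ∃[ x ] (x ∈ A × x ∈ B)
subsets-meet {n} A B n<∣A∣+∣B∣ with meet? A B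
... | yes common = common
... | no  disjoint = contradiction n<∣A∣+∣B∣ (≤⇒≯ ∣A∣+∣B∣≤n)
  where
  A⊆∁B : A ⊆ ∁ B
  A⊆∁B {x} x∈A = x∉p⇒x∈∁p (λ x∈B → disjoint (x , x∈A , x∈B))
  ∣A∣+∣B∣≤n : ∣ A ∣ + ∣ B ∣ ≤ n
  ∣A∣+∣B∣≤n = m≤o∸n⇒m+n≤o ∣ A ∣ (∣p∣≤n B)
                (≤-trans (p⊆q⇒∣p∣≤∣q∣ A⊆∁B) (≤-reflexive (∣∁p∣≡n∸∣p∣ B)))

Reach : ∀ {n d} (G : SPG n d) → ℕ → Fin (SPG.k G) → Fin (SPG.k G) → Set
Reach G D u v = ∃[ m ] (m ≤ D × Walk (λ _ → ⊤) (SPG.E G) u v m)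

reach-mono : ∀ {n d} (G : SPG n d) {D D′ u v} → D ≤ D′ → Reach G D u v → Reach G D′ u v
reach-mono _ D≤D′ (m , m≤D , w) = m , ≤-trans m≤D D≤D′ , w

reach-trans : ∀ {n d} (G : SPG n d) {D D′ u w v} →
              Reach G D u w → Reach G D′ w v → Reach G (D + D′) u v
reach-trans _ (m , m≤D , w) (m′ , m′≤D′ , w′) = m + m′ , +-mono-≤ m≤D m′≤D′ , w ++ʷ w′

shortReach : ∀ {n d} (G : SPG n d) {P : Fin (SPG.k G) → Set} {N : ℕ}
             (code : ∀ x → P x → Fin N) → (∀ {x y} p q → code x p ≡ code y q → x ≡ y) →
             ∀ {u v m} → Walk P (SPG.E G) u v m → Reach G (pred N) u v
shortReach G code code-injective w with shortWalk code code-injective w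
... | m , m<N , w′ = m , <⇒≤pred m<N , forget w′

module _ {n : ℕ} (G : SPG n 2) where
  open SPG G

  rep : Fin k → Subset n
  rep x = proj₁ (nonempty x)

  rep-part : ∀ x → part (rep x) ≡ just x
  rep-part x = proj₂ (nonempty x)

  rep-size : ∀ x → ∣ rep x ∣ ≡ 2
  rep-size x = part-dim (rep x) x (rep-part x)

  same-set⇒same-vertex : ∀ {A B x y} → A ≡ B → part A ≡ just x → part B ≡ just y → x ≡ y
  same-set⇒same-vertex refl A∈x A∈y = just-injective (trans (sym A∈x) A∈y)

  vertexIndex : ∀ x → ⊤ → Fin (choose2 n)
  vertexIndex x _ = index₂ (rep x) (rep-size x)

  vertexIndex-injective : ∀ {x y} p q → vertexIndex x p ≡ vertexIndex y q → x ≡ y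
  vertexIndex-injective {x} {y} _ _ same =
    same-set⇒same-vertex (index₂-injective _ _ _ _ same) (rep-part x) (rep-part y)

  reach-pairs : ∀ u v → Reach G (pred (choose2 n)) u v
  reach-pairs u v = shortReach G vertexIndex vertexIndex-injective (proj₂ (connected u v tt tt))

module _ {n : ℕ} (G : SPG (suc n) 2) where
  open SPG G

  survivorIndex : ∀ s x → Survives G ⁅ s ⁆ x → Fin n
  survivorIndex s x (A , ⁅s⁆⊆A , A∈x) = partnerIndex s A (⁅s⁆⊆A (x∈⁅x⁆ s)) (part-dim A x A∈x)

  survivorIndex-injective : ∀ s {x y} p q → survivorIndex s x p ≡ survivorIndex s y q → x ≡ y
  survivorIndex-injective s (A , _ , A∈x) (B , _ , B∈y) same =
    same-set⇒same-vertex G (partnerIndex-injective s A B _ _ _ _ same) A∈x B∈y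

  ⁅⁆⊆ : ∀ {s : Fin (suc n)} {A} → s ∈ A → ⁅ s ⁆ ⊆ A
  ⁅⁆⊆ {s} {A} s∈A x∈⁅s⁆ = subst (_∈ A) (sym (x∈⁅y⁆⇒x≡y s x∈⁅s⁆)) s∈A

  -- (b) Vertices containing 2-sets with a common symbol s are joined inside the
  -- connected restriction G_{s}, which has at most n vertices.
  reach-shared : DimReduction G → ∀ {s u v A B} →
                 s ∈ A → part A ≡ just u → s ∈ B → part B ≡ just v → Reach G (pred n) u v
  reach-shared dr {s} {u} {v} s∈A A∈u s∈B B∈v =
    shortReach G (survivorIndex s) (survivorIndex-injective s)
      (proj₂ (dr ⁅ s ⁆ ∣⁅s⁆∣≤2 u v (_ , ⁅⁆⊆ s∈A , A∈u) (_ , ⁅⁆⊆ s∈B , B∈v)))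
    where
    ∣⁅s⁆∣≤2 : ∣ ⁅ s ⁆ ∣ ≤ 2
    ∣⁅s⁆∣≤2 = ≤-trans (≤-reflexive (∣⁅x⁆∣≡1 s)) (s≤s z≤n)

module _ {n : ℕ} (G : SPG (2 + n) 2) where
  open SPG G

  -- (c) If some 2-set X is not used, vertex codes avoid the code of X, so the
  -- diameter is less than the number of 2-subsets minus one.
  reach-missing : ∀ X (∣X∣≡2 : ∣ X ∣ ≡ 2) → part X ≡ nothing →
                  ∀ u v → Reach G (pred (pred (choose2 (2 + n)))) u v
  reach-missing X ∣X∣≡2 X∉𝒜 u v =
    shortReach G avoidingIndex avoidingIndex-injective (proj₂ (connected u v tt tt))
    where
    X≢rep : ∀ x → index₂ X ∣X∣≡2 ≢ vertexIndex G x tt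
    X≢rep x same with trans (sym X∉𝒜) (subst (λ A → part A ≡ just x)
                              (sym (index₂-injective _ _ _ _ same)) (rep-part G x))
    ... | ()
    avoidingIndex : ∀ x → ⊤ → Fin (pred (choose2 (2 + n)))
    avoidingIndex x _ = punchOut (X≢rep x)
    avoidingIndex-injective : ∀ {x y} p q → avoidingIndex x p ≡ avoidingIndex y q → x ≡ y
    avoidingIndex-injective {x} {y} _ _ same =
      vertexIndex-injective G tt tt (punchOut-injective (X≢rep x) (X≢rep y) same)

pairs-bound : ∀ t → pred (choose2 (5 + t)) ≤ (3 + t) ^ 2
pairs-bound zero    = ≤-refl
pairs-bound (suc t) = begin
  (4 + t) + choose2 (5 + t)                 ≤⟨ +-monoʳ-≤ (4 + t) (s≤s (pairs-bound t)) ⟩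
  (4 + t) + suc ((3 + t) ^ 2)               ≤⟨ m≤n+m _ (t + 2) ⟩
  (t + 2) + ((4 + t) + suc ((3 + t) ^ 2))   ≡⟨ square-step t ⟩
  (4 + t) ^ 2                               ∎
  where
  open ≤-Reasoning
  -- (4+t)² = (3+t)² + 2t + 7, with the squares unfolded for the ring solver.
  square-step : ∀ t → (t + 2) + ((4 + t) + suc ((3 + t) * ((3 + t) * 1))) ≡ (4 + t) * ((4 + t) * 1)
  square-step = solve-∀

-- n = 3: two 2-subsets of a 3-set always meet, so (b) applies to every pair.
diameter-three : (G : SPG 3 2) → DimReduction G → DiameterAtMost G 1
diameter-three G dr u v with subsets-meet (rep G u) (rep G v) (3<∣u∣+∣v∣ u v)
  where
  3<∣u∣+∣v∣ : ∀ u v → 3 < ∣ rep G u ∣ + ∣ rep G v ∣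
  3<∣u∣+∣v∣ u v = subst₂ (λ a b → 3 < a + b) (sym (rep-size G u)) (sym (rep-size G v)) ≤-refl
... | s , s∈u , s∈v = reach-shared G dr s∈u (rep-part G u) s∈v (rep-part G v)

-- n = 4: meeting 2-sets are at distance ≤ 2 by (b); for disjoint ones, with a and c
-- in the respective 2-sets, either {a, c} lies in a part V_w and (b) gives ≤ 2 + 2
-- through w, or {a, c} ∉ 𝒜 and (c) gives ≤ 6 - 2.
diameter-four : (G : SPG 4 2) → DimReduction G → DiameterAtMost G 4
diameter-four G dr u v with meet? (rep G u) (rep G v)
... | yes (s , s∈u , s∈v) =
  reach-mono G (m≤m+n 2 2) (reach-shared G dr s∈u (rep-part G u) s∈v (rep-part G v))
... | no  disjoint = through-pair (member (rep G u) (rep-size G u)) (member (rep G v) (rep-size G v))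
  where
  through-pair : Nonempty (rep G u) → Nonempty (rep G v) → Reach G 4 u v
  through-pair (a , a∈u) (c , c∈v) with SPG.part G (⁅ a ⁆ ∪ ⁅ c ⁆) in X-part
  ... | just w  = reach-trans G (reach-shared G dr a∈u (rep-part G u) a∈X X-part)
                                (reach-shared G dr c∈X X-part c∈v (rep-part G v))
    where
    a∈X : a ∈ ⁅ a ⁆ ∪ ⁅ c ⁆
    a∈X = p⊆p∪q ⁅ c ⁆ (x∈⁅x⁆ a)
    c∈X : c ∈ ⁅ a ⁆ ∪ ⁅ c ⁆
    c∈X = q⊆p∪q ⁅ a ⁆ ⁅ c ⁆ (x∈⁅x⁆ c)
  ... | nothing = reach-missing G (⁅ a ⁆ ∪ ⁅ c ⁆) (pair-size a c a≢c) X-part u v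
    where
    a≢c : a ≢ c
    a≢c a≡c = disjoint (a , a∈u , subst (_∈ rep G v) (sym a≡c) c∈v)

lemma2 : ∀ (n : ℕ) → 2 ≤ n → (G : SPG n 2) → DimReduction G →
    DiameterAtMost G ((n ∸ 2) ^ 2)
lemma2 1 (s≤s ())
lemma2 2 _ G dr = reach-pairs G
lemma2 3 _ G dr = diameter-three G dr
lemma2 4 _ G dr = diameter-four G dr
lemma2 (suc (suc (suc (suc (suc t))))) _ G dr u v = reach-mono G (pairs-bound t) (reach-pairs G u v)
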